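{- Let $A[1..n]$ be an array of $n$ integers and set $A[0]=-\infty$. There is an algorithm that computes the LRM-Tree $\mathcal{T}_A$ of $A$ using at most $2n$ comparisons between elements of $A$ (data comparisons).
   Context: For $1\le i\le n$, the previous smaller value of position $i$ is $\mathrm{PSV}_A(i)=\max\{j\in[0..i-1] : A[j]<A[i]\}$ (well defined since $A[0]=-\infty$). The LRM-Tree (Left-to-Right-Minima Tree) $\mathcal{T}_A$ of $A$ is the ordered labeled tree with vertex set $\{0,1,\dots,n\}$, rooted at $0$, in which for every $1\le i\le n$ the parent of node $i$ is $\mathrm{PSV}_A(i)$, and the children of each node are ordered increasingly from left to right. -}

module Defs where

open import Data.Nat using (ℕ; zero; suc; _+_; _<_)
open import Data.Integer as ℤ using (ℤ)
open import Data.Fin using (Fin; zero; suc; toℕ)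
open import Data.Vec using (Vec; lookup)
open import Data.Bool using (Bool; true; false)
open import Data.Product using (_×_; _,_)
open import Relation.Nullary using (¬_)
open import Relation.Nullary.Decidable using (⌊_⌋)

data ℤ∞ : Set where
  -∞  : ℤ∞
  fin : ℤ → ℤ∞

data _<∞_ : ℤ∞ → ℤ∞ → Set where
  -∞<fin  : ∀ {b} → -∞ <∞ fin b
  fin<fin : ∀ {a b} → a ℤ.< b → fin a <∞ fin b

_<∞ᵇ_ : ℤ∞ → ℤ∞ → Bool
-∞    <∞ᵇ -∞    = false
-∞    <∞ᵇ fin _ = true
fin _ <∞ᵇ -∞    = false
fin a <∞ᵇ fin b = ⌊ a ℤ.<? b ⌋

-- The array A[0..n] with A[0] = -∞ and A[i] = i-th entry of the input (1-based).
ext : ∀ {n} → Vec ℤ n → Fin (suc n) → ℤ∞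
ext A zero    = -∞
ext A (suc i) = fin (lookup A i)

IsPSV : ∀ {n} → Vec ℤ n → Fin (suc n) → Fin (suc n) → Set
IsPSV {n} A i j =
  (toℕ j < toℕ i) × (ext A j <∞ ext A i) ×
  (∀ (k : Fin (suc n)) → toℕ j < toℕ k → toℕ k < toℕ i → ¬ (ext A k <∞ ext A i))

-- The LRM-tree T_A is the ordered tree on {0..n}, rooted at 0, whose node i ≥ 1
-- has parent PSV_A(i), children ordered increasingly; it is thus determined by
-- its parent array.  A parent array par (entry for node i+1 at index i) is
-- the LRM-tree of A iff every entry is the PSV.
IsLRMTree : ∀ {n} → Vec ℤ n → Vec (Fin (suc n)) n → Set
IsLRMTree {n} A par = ∀ (i : Fin n) → IsPSV A (suc i) (lookup par i)

-- Comparison-based algorithms (decision trees) on positions 0..m-1: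
-- an algorithm either returns a result or asks the comparison "A[i] < A[j]?"
-- and continues depending on the Boolean answer.
data Cmp (m : ℕ) (R : Set) : Set where
  ret : R → Cmp m R
  ask : Fin m → Fin m → (Bool → Cmp m R) → Cmp m R

run : ∀ {m R} → (Fin m → Fin m → Bool) → Cmp m R → R × ℕ
run o (ret r) = r , 0
run o (ask i j k) with run o (k (o i j))
... | r , c = r , suc c

oracle : ∀ {n} → Vec ℤ n → Fin (suc n) → Fin (suc n) → Bool
oracle A i j = ext A i <∞ᵇ ext A j

-- Scan A from left to right keeping a stack of positions: to process i, pop
-- every q with A[q] ≥ A[i], report the surviving top (or 0 if the stack is
-- empty) as the parent of i, and push i.  Invariant: every position k seen so
-- far is covered by a stack entry q ≥ k with A[q] ≤ A[k], so every position
-- strictly between the reported parent and i is covered by a popped entry and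
-- has a value ≥ A[i].  Each comparison either pops a position (once per
-- position) or ends the popping for i (once per i), hence at most 2n of them.
module Submission where

open import Defs
open import Data.Nat using (ℕ; suc; _+_; _*_; _≤_; _<_; z≤n; s≤s; s≤s⁻¹)
open import Data.Nat.Properties
open import Data.Nat.Tactic.RingSolver using (solve-∀)
open import Data.Integer using (ℤ)
import Data.Integer.Properties as ℤ
open import Data.Fin using (Fin; zero; suc; toℕ)
open import Data.Fin.Properties using (toℕ-injective)
open import Data.Vec using (Vec; []; _∷_; lookup; allFin)
open import Data.Vec.Properties using (lookup-allFin)
open import Data.Vec.Relation.Binary.Pointwise.Inductive as Pointwise using (Pointwise; []; _∷_)
open import Data.List using (List; []; _∷_; _++_; length)
open import Data.List.Relation.Unary.All as All using (All; []; _∷_)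
import Data.List.Relation.Unary.All.Properties as All
open import Data.List.Relation.Unary.Any using (Any; here; there)
import Data.List.Relation.Unary.Any.Properties as Any
open import Data.List.Relation.Unary.AllPairs using (AllPairs; []; _∷_)
open import Data.Bool using (Bool; true; false; if_then_else_)
open import Data.Product using (Σ; _×_; _,_; proj₁; proj₂)
open import Data.Sum using (_⊎_; inj₁; inj₂; [_,_]′)
open import Data.Empty using (⊥-elim)
open import Function using (_∘_)
open import Relation.Nullary using (¬_; yes; no)
open import Relation.Binary.PropositionalEquality

<∞ᵇ⇒<∞ : ∀ x y → x <∞ᵇ y ≡ true → x <∞ y
<∞ᵇ⇒<∞ -∞      (fin b) _ = -∞<fin
<∞ᵇ⇒<∞ (fin a) (fin b) e with a ℤ.<? b
... | yes a<b = fin<fin a<b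

<∞⇒<∞ᵇ : ∀ {x y} → x <∞ y → x <∞ᵇ y ≡ true
<∞⇒<∞ᵇ -∞<fin                 = refl
<∞⇒<∞ᵇ (fin<fin {a} {b} a<b) with a ℤ.<? b
... | yes _   = refl
... | no a≮b = ⊥-elim (a≮b a<b)

<∞ᵇ≡false⇒≮∞ : ∀ {x y} → x <∞ᵇ y ≡ false → ¬ (x <∞ y)
<∞ᵇ≡false⇒≮∞ e x<y with () ← trans (sym e) (<∞⇒<∞ᵇ x<y)

<∞-irrefl : ∀ {x} → ¬ (x <∞ x)
<∞-irrefl (fin<fin a<a) = ℤ.<-irrefl refl a<a

≮∞-trans : ∀ {x y z} → ¬ (x <∞ y) → ¬ (y <∞ z) → ¬ (x <∞ z)
≮∞-trans {y = -∞}    x≮y y≮z -∞<fin = y≮z -∞<fin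
≮∞-trans {y = fin b} x≮y y≮z -∞<fin = x≮y -∞<fin
≮∞-trans {y = -∞}    x≮y y≮z (fin<fin a<c) = y≮z -∞<fin
≮∞-trans {y = fin b} x≮y y≮z (fin<fin a<c) =
  ℤ.<⇒≱ a<c (ℤ.≤-trans (ℤ.≮⇒≥ (y≮z ∘ fin<fin)) (ℤ.≮⇒≥ (x≮y ∘ fin<fin)))

allPairs-++⁻ʳ : ∀ {a r} {X : Set a} {R : X → X → Set r} xs {ys} →
                AllPairs R (xs ++ ys) → AllPairs R ys
allPairs-++⁻ʳ []       rs       = rs
allPairs-++⁻ʳ (x ∷ xs) (_ ∷ rs) = allPairs-++⁻ʳ xs rs

module _ {m : ℕ} where

  infixl 1 _>>=_

  _>>=_ : ∀ {R S} → Cmp m R → (R → Cmp m S) → Cmp m S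
  ret r     >>= f = f r
  ask i j k >>= f = ask i j (λ b → k b >>= f)

  result : ∀ {R} → (Fin m → Fin m → Bool) → Cmp m R → R
  result o c = proj₁ (run o c)

  cost : ∀ {R} → (Fin m → Fin m → Bool) → Cmp m R → ℕ
  cost o c = proj₂ (run o c)

  result->>= : ∀ {R S} o (c : Cmp m R) (f : R → Cmp m S) →
               result o (c >>= f) ≡ result o (f (result o c))
  result->>= o (ret r)     f = refl
  result->>= o (ask i j k) f = result->>= o (k (o i j)) f

  cost->>= : ∀ {R S} o (c : Cmp m R) (f : R → Cmp m S) →
             cost o (c >>= f) ≡ cost o c + cost o (f (result o c))
  cost->>= o (ret r)     f = refl
  cost->>= o (ask i j k) f = cong suc (cost->>= o (k (o i j)) f)

module _ {n : ℕ} where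

  popUntilSmaller : Fin (suc n) → List (Fin (suc n)) → Cmp (suc n) (Fin (suc n) × List (Fin (suc n)))
  popUntilSmaller i []      = ret (zero , [])
  popUntilSmaller i (j ∷ S) = ask j i λ j<i →
    if j<i then ret (j , j ∷ S) else popUntilSmaller i S

  lrmParents : ∀ {r} → Vec (Fin n) r → List (Fin (suc n)) → Cmp (suc n) (Vec (Fin (suc n)) r)
  lrmParents []        S = ret []
  lrmParents (ix ∷ is) S =
    popUntilSmaller (suc ix) S >>= λ (p , S′) →
    lrmParents is (suc ix ∷ S′) >>= λ ps →
    ret (p ∷ ps)

  module _ (o : Fin (suc n) → Fin (suc n) → Bool) (ix : Fin n) {r} (is : Vec (Fin n) r) (S : List (Fin (suc n))) where

    private
      popped : Fin (suc n) × List (Fin (suc n))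
      popped = result o (popUntilSmaller (suc ix) S)
      rest : Cmp (suc n) (Vec (Fin (suc n)) r)
      rest = lrmParents is (suc ix ∷ proj₂ popped)

    result-lrmParents-∷ : result o (lrmParents (ix ∷ is) S) ≡ proj₁ popped ∷ result o rest
    result-lrmParents-∷ = trans (result->>= o (popUntilSmaller (suc ix) S) _) (result->>= o rest _)

    cost-lrmParents-∷ : cost o (lrmParents (ix ∷ is) S) ≡ cost o (popUntilSmaller (suc ix) S) + cost o rest
    cost-lrmParents-∷ = trans (cost->>= o (popUntilSmaller (suc ix) S) _)
                              (cong (cost o (popUntilSmaller (suc ix) S) +_)
                                    (trans (cost->>= o rest _) (+-identityʳ _)))

  cost-popUntilSmaller : ∀ o i S →
    cost o (popUntilSmaller i S) + length (proj₂ (result o (popUntilSmaller i S))) ≤ suc (length S)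
  cost-popUntilSmaller o i []      = z≤n
  cost-popUntilSmaller o i (j ∷ S) with o j i
  ... | true  = ≤-refl
  ... | false = s≤s (cost-popUntilSmaller o i S)

  cost-lrmParents : ∀ {r} o (is : Vec (Fin n) r) S → cost o (lrmParents is S) ≤ 2 * r + length S
  cost-lrmParents o []        S = z≤n
  cost-lrmParents {suc r} o (ix ∷ is) S = begin
    cost o (lrmParents (ix ∷ is) S)               ≡⟨ cost-lrmParents-∷ o ix is S ⟩
    c + cost o (lrmParents is (suc ix ∷ S′))      ≤⟨ +-monoʳ-≤ c (cost-lrmParents o is (suc ix ∷ S′)) ⟩
    c + (2 * r + suc (length S′))                 ≡⟨ shift c r (length S′) ⟩
    2 * r + suc (c + length S′)                   ≤⟨ +-monoʳ-≤ (2 * r) (s≤s (cost-popUntilSmaller o (suc ix) S)) ⟩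
    2 * r + suc (suc (length S))                  ≡⟨ double-suc r (length S) ⟩
    2 * suc r + length S                          ∎
    where
    open ≤-Reasoning
    c : ℕ
    c = cost o (popUntilSmaller (suc ix) S)
    S′ : List (Fin (suc n))
    S′ = proj₂ (result o (popUntilSmaller (suc ix) S))
    shift : ∀ a b d → a + (2 * b + suc d) ≡ 2 * b + suc (a + d)
    shift = solve-∀
    double-suc : ∀ a b → 2 * a + suc (suc b) ≡ 2 * suc a + b
    double-suc = solve-∀

module _ {n : ℕ} (A : Vec ℤ n) where

  Pos : Set
  Pos = Fin (suc n)

  _≮_ : Pos → Pos → Set
  q ≮ i = ¬ (ext A q <∞ ext A i)

  Covers : Pos → Pos → Set
  Covers k q = toℕ k ≤ toℕ q × k ≮ q

  record StackInv (c : ℕ) (S : List Pos) : Set where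
    field
      bounded    : All (λ s → toℕ s ≤ c) S
      decreasing : AllPairs (λ s t → toℕ t < toℕ s) S
      covering   : ∀ k → 0 < toℕ k → toℕ k ≤ c → Any (Covers k) S

  data StopsAt (i : Pos) : Pos → List Pos → Set where
    bottom  : StopsAt i zero []
    smaller : ∀ {j S} → ext A j <∞ ext A i → StopsAt i j (j ∷ S)

  record PopsTo (i : Pos) (S : List Pos) (p : Pos) (S′ : List Pos) : Set where
    field
      popped    : List Pos
      split     : S ≡ popped ++ S′
      notBelow  : All (_≮ i) popped
      stopsAt   : StopsAt i p S′

  popsTo-popUntilSmaller : ∀ i S → let (p , S′) = result (oracle A) (popUntilSmaller i S) in PopsTo i S p S′
  popsTo-popUntilSmaller i [] = record { popped = [] ; split = refl ; notBelow = [] ; stopsAt = bottom }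
  popsTo-popUntilSmaller i (j ∷ S) with oracle A j i in eq
  ... | true  = record { popped = [] ; split = refl ; notBelow = []
                       ; stopsAt = smaller (<∞ᵇ⇒<∞ (ext A j) (ext A i) eq) }
  ... | false = record { popped = j ∷ popped ; split = cong (j ∷_) split
                       ; notBelow = <∞ᵇ≡false⇒≮∞ eq ∷ notBelow ; stopsAt = stopsAt }
    where open PopsTo (popsTo-popUntilSmaller i S)

  ≮-popped : ∀ {k i P} → Any (Covers k) P → All (_≮ i) P → k ≮ i
  ≮-popped k∈P P≮i = let (q≮i , _ , k≮q) = All.lookupAny P≮i k∈P in ≮∞-trans k≮q q≮i

  ≤-top : ∀ {k j S} → AllPairs (λ s t → toℕ t < toℕ s) (j ∷ S) → Any (Covers k) (j ∷ S) → toℕ k ≤ toℕ j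
  ≤-top _         (here (k≤j , _)) = k≤j
  ≤-top (j>S ∷ _) (there k∈S)      = let (q<j , k≤q , _) = All.lookupAny j>S k∈S in ≤-trans k≤q (<⇒≤ q<j)

  isPSV-popsTo : ∀ {ix S p S′} → StackInv (toℕ ix) S → PopsTo (suc ix) S p S′ → IsPSV A (suc ix) p
  isPSV-popsTo {ix} {S′ = S′} inv record { popped = P ; split = refl ; notBelow = P≮i ; stopsAt = stop } = go stop
    where
    open StackInv inv
    between : ∀ k → 0 < toℕ k → toℕ k < suc (toℕ ix) → Any (Covers k) P ⊎ Any (Covers k) S′
    between k 0<k k<i = Any.++⁻ P (covering k 0<k (s≤s⁻¹ k<i))
    go : ∀ {p} → StopsAt (suc ix) p S′ → IsPSV A (suc ix) p
    go bottom = s≤s z≤n , -∞<fin , λ k 0<k k<i → [ (λ k∈P → ≮-popped k∈P P≮i) , (λ ()) ]′ (between k 0<k k<i)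
    go (smaller {j} j<i) = s≤s (All.lookup bounded (Any.++⁺ʳ P (here refl)))
                         , j<i
                         , λ k j<k k<i → [ (λ k∈P → ≮-popped k∈P P≮i)
                                          , (λ k∈S′ → ⊥-elim (<⇒≱ j<k (≤-top (allPairs-++⁻ʳ P decreasing) k∈S′))) ]′
                                          (between k (≤-trans (s≤s z≤n) j<k) k<i)

  stackInv-push : ∀ {ix S p S′} → StackInv (toℕ ix) S → PopsTo (suc ix) S p S′ → StackInv (suc (toℕ ix)) (suc ix ∷ S′)
  stackInv-push {ix} {S′ = S′} inv record { popped = P ; split = refl ; notBelow = P≮i } = record
    { bounded    = ≤-refl ∷ All.map m≤n⇒m≤1+n S′≤ix
    ; decreasing = All.map s≤s S′≤ix ∷ allPairs-++⁻ʳ P decreasing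
    ; covering   = covering′
    }
    where
    open StackInv inv
    S′≤ix : All (λ s → toℕ s ≤ toℕ ix) S′
    S′≤ix = All.++⁻ʳ P bounded
    covering′ : ∀ k → 0 < toℕ k → toℕ k ≤ suc (toℕ ix) → Any (Covers k) (suc ix ∷ S′)
    covering′ k 0<k k≤i with toℕ k ≟ suc (toℕ ix)
    ... | yes k≡i = here (k≤i , subst (λ q → k ≮ q) (toℕ-injective k≡i) <∞-irrefl)
    ... | no k≢i with Any.++⁻ P (covering k 0<k (s≤s⁻¹ (≤∧≢⇒< k≤i k≢i)))
    ...   | inj₁ k∈P  = here (k≤i , ≮-popped k∈P P≮i)
    ...   | inj₂ k∈S′ = there k∈S′

  pointwise-lrmParents : ∀ {c r} (is : Vec (Fin n) r) S →
    (∀ x → toℕ (lookup is x) ≡ c + toℕ x) → StackInv c S →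
    Pointwise (λ ix → IsPSV A (suc ix)) is (result (oracle A) (lrmParents is S))
  pointwise-lrmParents []        S consecutive inv = []
  pointwise-lrmParents {c} (ix ∷ is) S consecutive inv
    rewrite result-lrmParents-∷ (oracle A) ix is S =
    isPSV-popsTo inv′ pops ∷ pointwise-lrmParents is _ consecutive′ (stackInv-push inv′ pops)
    where
    ix≡c : toℕ ix ≡ c
    ix≡c = trans (consecutive zero) (+-identityʳ c)
    inv′ : StackInv (toℕ ix) S
    inv′ = subst (λ d → StackInv d S) (sym ix≡c) inv
    pops : let (p , S′) = result (oracle A) (popUntilSmaller (suc ix) S) in PopsTo (suc ix) S p S′
    pops = popsTo-popUntilSmaller (suc ix) S
    consecutive′ : ∀ x → toℕ (lookup is x) ≡ suc (toℕ ix) + toℕ x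
    consecutive′ x = trans (consecutive (suc x)) (trans (+-suc c (toℕ x)) (cong (λ d → suc (d + toℕ x)) (sym ix≡c)))

  emptyStackInv : StackInv 0 []
  emptyStackInv = record { bounded = [] ; decreasing = [] ; covering = λ k 0<k k≤0 → ⊥-elim (<⇒≱ 0<k k≤0) }

lemma1 : (n : ℕ) →
    Σ (Cmp (suc n) (Vec (Fin (suc n)) n)) λ alg →
      (A : Vec ℤ n) →
        IsLRMTree A (proj₁ (run (oracle A) alg)) × (proj₂ (run (oracle A) alg) ≤ 2 * n)
lemma1 n = alg , λ A → isLRMTree A , costBound A
  where
  alg : Cmp (suc n) (Vec (Fin (suc n)) n)
  alg = lrmParents (allFin n) []
  isLRMTree : ∀ A → IsLRMTree A (result (oracle A) alg)
  isLRMTree A x = subst (λ ix → IsPSV A (suc ix) (lookup (result (oracle A) alg) x)) (lookup-allFin x)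
    (Pointwise.lookup (pointwise-lrmParents A (allFin n) [] (cong toℕ ∘ lookup-allFin) (emptyStackInv A)) x)
  costBound : ∀ A → cost (oracle A) alg ≤ 2 * n
  costBound A = ≤-trans (cost-lrmParents (oracle A) (allFin n) []) (≤-reflexive (+-identityʳ (2 * n)))
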